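{- Let $N$ be a neuron, $id,len\in\mathbb{N}$, and suppose $\mathit{One\_input}(N,id,len)$ and that $N$ is initial. Then for every list $\mathit{inp}=[f_1;\dots;f_k]$ of input functions, either $Output_N(\mathit{inp},len)=[f_1(id);\dots;f_k(id)]\mathbin{++}[0]$, or for all booleans $a_1,a_2$ and lists of booleans $l_1,l_2$ with $Output_N(\mathit{inp},len)=l_1\mathbin{++}[a_1;a_2]\mathbin{++}l_2$ we have $a_1=0$ or $a_2=0$.
   Context: Booleans are identified with $0$ (false) and $1$ (true). A neuron $N$ consists of an identifier $id_N\in\mathbb{N}$, a weight function $w_N:\mathbb{N}\to\mathbb{Q}$ with $-1\le w_N(x)\le 1$ for all $x$ and $w_N(id_N)=0$, a leak factor $lk_N\in\mathbb{Q}$ with $0\le lk_N\le 1$, a threshold $\tau_N\in\mathbb{Q}$ with $\tau_N>0$, an output list $Output(N)$ of booleans (most recent first) and a current potential $CurPot(N)\in\mathbb{Q}$, subject to: $(\tau_N\le CurPot(N))$ equals the head of $Output(N)$ (the head of an empty list being $0$). An input function is a map $i:\mathbb{N}\to\{0,1\}$; $potential(w,i,len)=\sum_{0\le k<len,\ i(k)=1} w(k)$. The one-step update of $N$ with input function $i$ in an environment of $len$ neurons keeps $id,w,lk,\tau$, sets the new potential $p=potential(w_N,i,len)$ if $\tau_N\le CurPot(N)$ and $p=potential(w_N,i,len)+lk_N\cdot CurPot(N)$ otherwise, and sets the new output list to $(\tau_N\le p)::Output(N)$. For a list of input functions (most recent first), $AfterNsteps(N,[\,],len)=N$ and $AfterNsteps(N,i::\mathit{inp},len)$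 is the one-step update of $AfterNsteps(N,\mathit{inp},len)$ with $i$; $Output_N(\mathit{inp},len)$ denotes its output list. $N$ is initial if $Output(N)=[0]$ and $CurPot(N)=0$. $\mathit{One\_input}(N,id,len)$ means $id<len$ and $w_N(id')=0$ for all $id'\neq id$ with $id'<len$. $\mathbin{++}$ is list concatenation. -}

module Defs where

open import Data.Bool using (Bool; true; false; if_then_else_)
open import Data.Nat using (ℕ; zero; suc) renaming (_<_ to _<ℕ_)
open import Data.Rational using (ℚ; 0ℚ; 1ℚ; -_; _+_; _*_; _≤_; _<_)
open import Data.Rational.Properties using (_≤?_)
open import Data.List using (List; []; _∷_)
open import Relation.Nullary.Decidable using (⌊_⌋)
open import Relation.Binary.PropositionalEquality using (_≡_)

headB : List Bool → Bool
headB []      = false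
headB (b ∷ _) = b

leqB : ℚ → ℚ → Bool
leqB τ p = ⌊ τ ≤? p ⌋

record Neuron : Set where
  constructor mkNeuron
  field
    Id      : ℕ
    W       : ℕ → ℚ
    Lk      : ℚ
    Tau     : ℚ
    Output  : List Bool      -- most recent first
    CurPot  : ℚ
    W-lower : ∀ x → - 1ℚ ≤ W x
    W-upper : ∀ x → W x ≤ 1ℚ
    W-self  : W Id ≡ 0ℚ
    Lk-low  : 0ℚ ≤ Lk
    Lk-up   : Lk ≤ 1ℚ
    Tau-pos : 0ℚ < Tau
    Inv     : leqB Tau CurPot ≡ headB Output

InputFn : Set
InputFn = ℕ → Bool

potential : (ℕ → ℚ) → InputFn → ℕ → ℚ
potential w i zero    = 0ℚ
potential w i (suc n) = potential w i n + (if i n then w n else 0ℚ)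

nextPot : Neuron → InputFn → ℕ → ℚ
nextPot N i len =
  if leqB (Neuron.Tau N) (Neuron.CurPot N)
  then potential (Neuron.W N) i len
  else potential (Neuron.W N) i len + Neuron.Lk N * Neuron.CurPot N

NextNeuron : Neuron → InputFn → ℕ → Neuron
NextNeuron N i len = record
  { Id      = Id
  ; W       = W
  ; Lk      = Lk
  ; Tau     = Tau
  ; Output  = leqB Tau (nextPot N i len) ∷ Output
  ; CurPot  = nextPot N i len
  ; W-lower = W-lower
  ; W-upper = W-upper
  ; W-self  = W-self
  ; Lk-low  = Lk-low
  ; Lk-up   = Lk-up
  ; Tau-pos = Tau-pos
  ; Inv     = Relation.Binary.PropositionalEquality.refl
  }
  where open Neuron N

-- inputs listed most recent first
AfterNsteps : Neuron → List InputFn → ℕ → Neuron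
AfterNsteps N []        len = N
AfterNsteps N (i ∷ inp) len = NextNeuron (AfterNsteps N inp len) i len

OutputN : Neuron → List InputFn → ℕ → List Bool
OutputN N inp len = Neuron.Output (AfterNsteps N inp len)

IsInitial : Neuron → Set
IsInitial N = (Neuron.Output N ≡ false ∷ []) Data.Product.× (Neuron.CurPot N ≡ 0ℚ)
  where import Data.Product

One-input : Neuron → ℕ → ℕ → Set
One-input N id len = (id <ℕ len) Data.Product.× (∀ id' → id' Relation.Binary.PropositionalEquality.≢ id → id' <ℕ len → Neuron.W N id' ≡ 0ℚ)
  where import Data.Product

{-# OPTIONS --safe #-}
-- With a single input of weight w, the potential a neuron receives at each step is w when the
-- input fires and 0 otherwise; on top of it comes the leaked potential, which is 0 right after
-- a spike and otherwise lies in [0, τ) as long as the potential stays nonnegative.  If τ ≤ w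
-- the potential does stay nonnegative, and the neuron fires exactly when its input does.  If w < τ, a neuron that has just fired restarts from the bare input, which is
-- below τ, so it never fires at two consecutive steps.
module Submission where

open import Defs
open import Data.Bool using (Bool; true; false; if_then_else_)
open import Data.Nat using (ℕ; zero; suc) renaming (_<_ to _<ℕ_)
open import Data.Nat.Properties using (_≟_; n<1+n; <⇒≢; m<n⇒m<1+n; ≤∧≢⇒<; ≤-pred)
open import Data.List using (List; []; _∷_; _++_; map)
open import Data.Sum using (_⊎_; inj₁; inj₂)
open import Data.Product using (_×_; _,_; proj₂)
open import Relation.Nullary using (yes; no; contradiction)
open import Relation.Nullary.Decidable using (isYes≗does; dec-true; dec-false)
open import Relation.Binary.PropositionalEquality
  using (_≡_; _≢_; refl; sym; trans; cong; cong₂; subst; ≢-sym)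
open import Data.Rational using (ℚ; 0ℚ; _+_; _*_; _≤_; _<_; nonNegative)
open import Data.Rational.Properties
  using (_≤?_; ≤-refl; ≤-reflexive; ≤-trans; <⇒≤; ≰⇒>; <-irrefl; <-≤-trans; ≤-<-trans;
         +-identityˡ; +-identityʳ; +-mono-≤; *-monoʳ-≤-nonNeg; *-identityˡ; *-zeroˡ)

open Neuron

leqB-true : ∀ {τ p} → τ ≤ p → leqB τ p ≡ true
leqB-true {τ} {p} τ≤p = trans (isYes≗does (τ ≤? p)) (dec-true (τ ≤? p) τ≤p)

leqB-false : ∀ {τ p} → p < τ → leqB τ p ≡ false
leqB-false {τ} {p} p<τ =
  trans (isYes≗does (τ ≤? p)) (dec-false (τ ≤? p) λ τ≤p → <-irrefl refl (<-≤-trans p<τ τ≤p))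

leqB-false⁻¹ : ∀ {τ p} → leqB τ p ≡ false → p < τ
leqB-false⁻¹ eq = ≰⇒> λ τ≤p → contradiction (trans (sym (leqB-true τ≤p)) eq) λ ()

module _ {w : ℕ → ℚ} {i : InputFn} where

  potential-suc-vanishing : ∀ n → w n ≡ 0ℚ → potential w i (suc n) ≡ potential w i n
  potential-suc-vanishing n wn≡0 with i n
  ... | true  = trans (cong (potential w i n +_) wn≡0) (+-identityʳ _)
  ... | false = +-identityʳ _

  potential-vanishing : ∀ n → (∀ k → k <ℕ n → w k ≡ 0ℚ) → potential w i n ≡ 0ℚ
  potential-vanishing zero    _      = refl
  potential-vanishing (suc n) vanish =
    trans (potential-suc-vanishing n (vanish n (n<1+n n)))
          (potential-vanishing n λ k k<n → vanish k (m<n⇒m<1+n k<n))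

  potential-single : ∀ {id} n → id <ℕ n → (∀ k → k ≢ id → k <ℕ n → w k ≡ 0ℚ) →
                     potential w i n ≡ (if i id then w id else 0ℚ)
  potential-single {id} (suc n) id<1+n vanish with n ≟ id
  ... | yes refl =
    trans (cong (_+ (if i id then w id else 0ℚ)) (potential-vanishing n below)) (+-identityˡ _)
    where
    below : ∀ k → k <ℕ n → w k ≡ 0ℚ
    below k k<n = vanish k (<⇒≢ k<n) (m<n⇒m<1+n k<n)
  ... | no n≢id = trans (potential-suc-vanishing n (vanish n n≢id (n<1+n n)))
                        (potential-single n (≤∧≢⇒< (≤-pred id<1+n) (≢-sym n≢id))
                                          λ k k≢id k<n → vanish k k≢id (m<n⇒m<1+n k<n))

potential-one-input : ∀ M {id len} (i : InputFn) → One-input M id len →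
                      potential (W M) i len ≡ (if i id then W M id else 0ℚ)
potential-one-input M {len = len} i (id<len , vanish) = potential-single len id<len vanish

carriedPot : Neuron → ℚ
carriedPot M = if leqB (Tau M) (CurPot M) then 0ℚ else Lk M * CurPot M

nextPot-≡ : ∀ M i len → nextPot M i len ≡ potential (W M) i len + carriedPot M
nextPot-≡ M i len with leqB (Tau M) (CurPot M)
... | true  = sym (+-identityʳ _)
... | false = refl

leaked-nonneg : ∀ M {p} → 0ℚ ≤ p → 0ℚ ≤ Lk M * p
leaked-nonneg M {p} 0≤p =
  subst (_≤ Lk M * p) (*-zeroˡ p) (*-monoʳ-≤-nonNeg p {{nonNegative 0≤p}} (Lk-low M))

leaked-≤ : ∀ M {p} → 0ℚ ≤ p → Lk M * p ≤ p
leaked-≤ M {p} 0≤p =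
  subst (Lk M * p ≤_) (*-identityˡ p) (*-monoʳ-≤-nonNeg p {{nonNegative 0≤p}} (Lk-up M))

carriedPot-nonneg : ∀ M → 0ℚ ≤ CurPot M → 0ℚ ≤ carriedPot M
carriedPot-nonneg M 0≤cur with leqB (Tau M) (CurPot M)
... | true  = ≤-refl
... | false = leaked-nonneg M 0≤cur

carriedPot-<-Tau : ∀ M → 0ℚ ≤ CurPot M → carriedPot M < Tau M
carriedPot-<-Tau M 0≤cur with leqB (Tau M) (CurPot M) in fired
... | true  = Tau-pos M
... | false = ≤-<-trans (leaked-≤ M 0≤cur) (leqB-false⁻¹ fired)

nextPot-one-input : ∀ M {id len} i → One-input M id len →
                    nextPot M i len ≡ (if i id then W M id else 0ℚ) + carriedPot M
nextPot-one-input M {len = len} i oi =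
  trans (nextPot-≡ M i len) (cong (_+ carriedPot M) (potential-one-input M i oi))

nextPot-nonneg : ∀ M {id len} i → One-input M id len → 0ℚ ≤ W M id → 0ℚ ≤ CurPot M →
                 0ℚ ≤ nextPot M i len
nextPot-nonneg M {id} i oi 0≤w 0≤cur =
  subst (0ℚ ≤_) (sym (nextPot-one-input M i oi)) (input+carried-nonneg (i id))
  where
  0≤c : 0ℚ ≤ carriedPot M
  0≤c = carriedPot-nonneg M 0≤cur

  input+carried-nonneg : ∀ b → 0ℚ ≤ (if b then W M id else 0ℚ) + carriedPot M
  input+carried-nonneg true  = subst (_≤ W M id + carriedPot M) (+-identityʳ 0ℚ) (+-mono-≤ 0≤w 0≤c)
  input+carried-nonneg false = subst (0ℚ ≤_) (sym (+-identityˡ (carriedPot M))) 0≤c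

fires-iff-input : ∀ M {id len} i → One-input M id len → Tau M ≤ W M id → 0ℚ ≤ CurPot M →
                  leqB (Tau M) (nextPot M i len) ≡ i id
fires-iff-input M {id} i oi τ≤w 0≤cur =
  trans (cong (leqB (Tau M)) (nextPot-one-input M i oi)) (fires-iff (i id))
  where
  fires-iff : ∀ b → leqB (Tau M) ((if b then W M id else 0ℚ) + carriedPot M) ≡ b
  fires-iff true  = leqB-true (subst (_≤ W M id + carriedPot M) (+-identityʳ (Tau M))
                                     (+-mono-≤ τ≤w (carriedPot-nonneg M 0≤cur)))
  fires-iff false = leqB-false (subst (_< Tau M) (sym (+-identityˡ (carriedPot M)))
                                      (carriedPot-<-Tau M 0≤cur))

never-fires-twice : ∀ M {id len} i → One-input M id len → W M id < Tau M →
                    (leqB (Tau M) (nextPot M i len) ≡ false) ⊎ (headB (Output M) ≡ false)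
never-fires-twice M {id} i oi w<τ with leqB (Tau M) (CurPot M) in fired
... | false = inj₂ (trans (sym (Inv M)) fired)
-- The with-abstraction also reaches the test inside nextPot, which here reduces to the bare potential.
... | true  =
  inj₁ (leqB-false (subst (_< Tau M) (sym (potential-one-input M i oi)) (input<τ (i id))))
  where
  input<τ : ∀ b → (if b then W M id else 0ℚ) < Tau M
  input<τ true  = w<τ
  input<τ false = Tau-pos M

NoConsecutiveTrues : List Bool → Set
NoConsecutiveTrues l =
  ∀ a₁ a₂ l₁ l₂ → l ≡ l₁ ++ (a₁ ∷ a₂ ∷ []) ++ l₂ → (a₁ ≡ false) ⊎ (a₂ ≡ false)

[]-noConsecutiveTrues : NoConsecutiveTrues []
[]-noConsecutiveTrues _ _ []      _ ()
[]-noConsecutiveTrues _ _ (_ ∷ _) _ ()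

∷-noConsecutiveTrues : ∀ {b l} → (b ≡ false) ⊎ (headB l ≡ false) →
                       NoConsecutiveTrues l → NoConsecutiveTrues (b ∷ l)
∷-noConsecutiveTrues b∨head≡false _   _  _  []       _  refl = b∨head≡false
∷-noConsecutiveTrues _            ntt a₁ a₂ (_ ∷ l₁) l₂ refl = ntt a₁ a₂ l₁ l₂ refl

AfterNsteps-invariant : ∀ (P : Neuron → Set) {N len} → (∀ M i → P M → P (NextNeuron M i len)) →
                        P N → ∀ inp → P (AfterNsteps N inp len)
AfterNsteps-invariant P step pN []        = pN
AfterNsteps-invariant P step pN (i ∷ inp) = step _ i (AfterNsteps-invariant P step pN inp)

output-copies-input : ∀ N {id len} → One-input N id len → Tau N ≤ W N id → 0ℚ ≤ CurPot N →
                      ∀ inp → OutputN N inp len ≡ map (λ f → f id) inp ++ Output N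
output-copies-input N {id} {len} oi τ≤w 0≤cur = copies
  where
  Copying : Neuron → Set
  Copying M = One-input M id len × Tau M ≤ W M id × 0ℚ ≤ CurPot M

  copying-step : ∀ M i → Copying M → Copying (NextNeuron M i len)
  copying-step M i (oi , τ≤w , 0≤cur) =
    oi , τ≤w , nextPot-nonneg M i oi (≤-trans (<⇒≤ (Tau-pos M)) τ≤w) 0≤cur

  copies : ∀ inp → OutputN N inp len ≡ map (λ f → f id) inp ++ Output N
  copies []        = refl
  copies (i ∷ inp) with AfterNsteps-invariant Copying copying-step (oi , τ≤w , 0≤cur) inp
  ... | oi′ , τ≤w′ , 0≤cur′ =
    cong₂ _∷_ (fires-iff-input (AfterNsteps N inp len) i oi′ τ≤w′ 0≤cur′) (copies inp)

output-noConsecutiveTrues : ∀ N {id len} → One-input N id len → W N id < Tau N →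
                            NoConsecutiveTrues (Output N) →
                            ∀ inp → NoConsecutiveTrues (OutputN N inp len)
output-noConsecutiveTrues N {id} {len} oi w<τ ntt inp =
  proj₂ (proj₂ (AfterNsteps-invariant Filtering filtering-step (oi , w<τ , ntt) inp))
  where
  Filtering : Neuron → Set
  Filtering M = One-input M id len × W M id < Tau M × NoConsecutiveTrues (Output M)

  filtering-step : ∀ M i → Filtering M → Filtering (NextNeuron M i len)
  filtering-step M i (oi , w<τ , ntt) =
    oi , w<τ , ∷-noConsecutiveTrues (never-fires-twice M i oi w<τ) ntt

corollary4p10 : (N : Neuron) (id len : ℕ) → One-input N id len → IsInitial N →
    (inp : List InputFn) →
    (OutputN N inp len ≡ map (λ f → f id) inp ++ (false ∷ []))
    ⊎ (∀ (a₁ a₂ : Bool) (l₁ l₂ : List Bool) →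
         OutputN N inp len ≡ l₁ ++ (a₁ ∷ a₂ ∷ []) ++ l₂ →
         (a₁ ≡ false) ⊎ (a₂ ≡ false))
corollary4p10 N id len oi (output≡[false] , curPot≡0) inp with Tau N ≤? W N id
... | yes τ≤w = inj₁ (trans (output-copies-input N oi τ≤w (≤-reflexive (sym curPot≡0)) inp)
                            (cong (map (λ f → f id) inp ++_) output≡[false]))
... | no  τ≰w = inj₂ (output-noConsecutiveTrues N oi (≰⇒> τ≰w) [false]-noConsecutiveTrues inp)
  where
  [false]-noConsecutiveTrues : NoConsecutiveTrues (Output N)
  [false]-noConsecutiveTrues = subst NoConsecutiveTrues (sym output≡[false])
                                     (∷-noConsecutiveTrues (inj₁ refl) []-noConsecutiveTrues)
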